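{- Let $\mathfrak X$ be a homogeneous tree of degree $q+1$ ($q\geq1$) and let $\{f_j\}_{j\in\mathbb Z}$ be a wave on $\mathfrak X$. Then for all integers $n$ and $k$, $$f_{nk}=U_{n-1}\big(T_k(\mu_1)\big)f_k-U_{n-2}\big(T_k(\mu_1)\big)f_0.$$
   Context: $\mathfrak X$ is a tree in which every vertex has exactly $q+1$ edges; $\mathcal F(\mathfrak X)$ is the space of complex-valued functions on its vertices; $\mu_1f(v)=\frac{1}{q+1}\sum_{w\text{ adjacent to }v}f(w)$. A wave is a family $\{f_j\}_{j\in\mathbb Z}$ in $\mathcal F(\mathfrak X)$ with $\mu_1f_j=\frac{f_{j+1}+f_{j-1}}{2}$ for all $j$. $T_m$: Chebyshev polynomials of the first kind, $T_0=1$, $T_1(x)=x$, $T_{m+1}=2xT_m-T_{m-1}$, $T_{ -m}=T_m$. $U_n$: Chebyshev polynomials of the second kind, $U_0=1$, $U_1(x)=2x$, $U_k=2xU_{k-1}-U_{k-2}$, with $U_{ -n-1}=-U_{n-1}$ for $n\geq0$ (so $U_{ -1}=0$, $U_{ -2}=-1$). Polynomials are applied to operators in the usual way. -}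

module Defs where

open import Algebra.Bundles using (CommutativeRing)
open import Data.Nat using (ℕ; zero; suc)
open import Data.Fin using (Fin; zero; suc; _≟_)
open import Data.List using (List; []; _∷_)
open import Data.Unit using (⊤; tt)
open import Data.Product using (Σ; _×_; _,_; proj₂)
open import Data.Integer using (ℤ; +_; -[1+_]; ∣_∣)
import Data.Integer as ℤ
open import Relation.Nullary using (yes; no)
open import Relation.Binary.PropositionalEquality using (_≢_)

-- The homogeneous tree of degree q+1.
-- Concrete model: the Cayley graph of the free product of q+1 copies of
-- Z/2, i.e. vertices are reduced words over the alphabet Fin (q+1)
-- (no two consecutive letters equal); the neighbours of a word w are the
-- q+1 words  step w a  (a : Fin (q+1)), obtained by multiplying w on the
-- left by the generator a (prepend a, or cancel it if w starts with a).
-- Every vertex has exactly q+1 distinct neighbours and the graph is a tree.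

Reduced : ∀ {n} → List (Fin n) → Set
Reduced [] = ⊤
Reduced (x ∷ []) = ⊤
Reduced (x ∷ y ∷ r) = (x ≢ y) × Reduced (y ∷ r)

Vertex : ℕ → Set
Vertex q = Σ (List (Fin (suc q))) Reduced

reduced-tail : ∀ {n} (x : Fin n) (r : List (Fin n)) → Reduced (x ∷ r) → Reduced r
reduced-tail x [] p = tt
reduced-tail x (y ∷ r) p = proj₂ p

step : ∀ {q} → Vertex q → Fin (suc q) → Vertex q
step ([] , _) a = (a ∷ [] , tt)
step (x ∷ r , p) a with a ≟ x
... | yes _ = (r , reduced-tail x r p)
... | no a≢x = (a ∷ x ∷ r , a≢x , p)

-- Functions on the vertices with values in a commutative ring R
-- (the paper uses R = ℂ).

module _ {c ℓ} (R : CommutativeRing c ℓ) where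
  open CommutativeRing R hiding (zero)

  fromℕ : ℕ → Carrier
  fromℕ zero = 0#
  fromℕ (suc n) = 1# + fromℕ n

  two : Carrier
  two = 1# + 1#

  Fn : ℕ → Set c
  Fn q = Vertex q → Carrier

  Op : ℕ → Set c
  Op q = Fn q → Fn q

  sumFin : ∀ {n} → (Fin n → Carrier) → Carrier
  sumFin {zero} g = 0#
  sumFin {suc n} g = g zero + sumFin (λ i → g (suc i))

  -- μ₁ f (v) = (1/(q+1)) Σ_{w ~ v} f(w), where invq1 = 1/(q+1)
  μ₁ : ∀ q → (invq1 : Carrier) → Op q
  μ₁ q invq1 f v = invq1 * sumFin (λ a → f (step v a))

  -- wave: μ₁ f_j = (f_{j+1} + f_{j-1}) / 2, where inv2 = 1/2
  IsWave : ∀ q → (invq1 inv2 : Carrier) → (ℤ → Fn q) → Set ℓ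
  IsWave q invq1 inv2 f =
    ∀ (j : ℤ) (v : Vertex q) →
      μ₁ q invq1 (f j) v ≈ inv2 * (f (j ℤ.+ ℤ.1ℤ) v + f (j ℤ.- ℤ.1ℤ) v)

  chebT : ∀ {q} → Op q → ℕ → Op q
  chebT A zero g = g
  chebT A (suc zero) g = A g
  chebT A (suc (suc m)) g v = two * A (chebT A (suc m) g) v - chebT A m g v

  chebU : ∀ {q} → Op q → ℕ → Op q
  chebU A zero g = g
  chebU A (suc zero) g v = two * A g v
  chebU A (suc (suc m)) g v = two * A (chebU A (suc m) g) v - chebU A m g v

  chebTℤ : ∀ {q} → Op q → ℤ → Op q
  chebTℤ A k = chebT A ∣ k ∣

  -- U_{-n-1} = - U_{n-1} (n ≥ 0), with U_{-1} = 0
  chebUℤ : ∀ {q} → Op q → ℤ → Op q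
  chebUℤ A (+ n) = chebU A n
  chebUℤ A -[1+ zero ] g v = 0#
  chebUℤ A -[1+ suc m ] g v = - chebU A m g v

{-# OPTIONS --safe #-}
module Submission where

-- A wave for a linear operator A is a sequence h with h(n+1) + h(n-1) = 2·A h(n);
-- it is determined by h(0) and h(1), so two waves agreeing there agree everywhere.
-- Applied to n ↦ f(j+n) + f(j-n) and n ↦ 2·T_n(μ₁) f(j) this gives
-- f(j+m) + f(j-m) = 2·T_m(μ₁) f(j), which says that n ↦ f(nk) is a wave for T_k(μ₁).
-- Applied to h and n ↦ U_{n-1}(A) h(1) - U_{n-2}(A) h(0), a wave for A by the
-- Chebyshev recursion, it expands any wave h in terms of its two initial values.

open import Defs
open import Algebra.Bundles using (CommutativeRing)
open import Data.Nat using (ℕ; _≤_)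
open import Data.Integer using (ℤ; _*_; _-_; 0ℤ; 1ℤ; +_)

open import Level using (_⊔_)
open import Data.Nat using (zero; suc)
open import Data.Fin using (Fin; zero; suc)
open import Data.Integer as ℤ using (-[1+_]; -1ℤ; ∣_∣)
import Data.Integer.Properties as ℤ
open import Data.Integer.Tactic.RingSolver using (solve-∀)
open import Data.Product using (_×_; _,_; proj₁)
open import Function using (id; _∘_)
open import Relation.Binary.PropositionalEquality as ≡ using (_≡_)
import Relation.Binary.Reasoning.Setoid as SetoidReasoning

private
  i+[1+j]≡1+[i+j] : ∀ i j → i ℤ.+ (1ℤ ℤ.+ j) ≡ 1ℤ ℤ.+ (i ℤ.+ j)
  i+[1+j]≡1+[i+j] = solve-∀

  [1+n]*k≡n*k+k : ∀ n k → (1ℤ ℤ.+ n) * k ≡ n * k ℤ.+ k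
  [1+n]*k≡n*k+k = solve-∀

  [-1+n]*k≡n*k-k : ∀ n k → (ℤ.- 1ℤ ℤ.+ n) * k ≡ n * k - k
  [-1+n]*k≡n*k-k = solve-∀

  -1+[-1+n]≡n-2 : ∀ n → ℤ.- 1ℤ ℤ.+ (ℤ.- 1ℤ ℤ.+ n) ≡ n - + 2
  -1+[-1+n]≡n-2 = solve-∀

module Waves {c ℓ} (R : CommutativeRing c ℓ) (q : ℕ) where
  open CommutativeRing R hiding (zero) renaming (_*_ to _·_; _-_ to _−_)
  open import Algebra.Properties.AbelianGroup +-abelianGroup
    using (//-rightDividesˡ; ∙-cancelˡ; ∙-cancelʳ; ⁻¹-∙-comm; ε⁻¹≈ε; ⁻¹-involutive)
  open import Algebra.Properties.Ring ring using (-1*x≈-x; -‿distribʳ-*; x[y-z]≈xy-xz)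
  open import Algebra.Properties.CommutativeSemigroup +-commutativeSemigroup using (interchange)
  open import Algebra.Properties.CommutativeSemigroup *-commutativeSemigroup using (x∙yz≈y∙xz)
  open import Algebra.Properties.Semiring.Sum semiring using (sum; sum-cong-≋; ∑-distrib-+; *-distribˡ-sum)
  open SetoidReasoning setoid

  x+x≈two·x : ∀ x → x + x ≈ two R · x
  x+x≈two·x x = begin
    x + x             ≈⟨ +-cong (*-identityˡ x) (*-identityˡ x) ⟨
    1# · x + 1# · x   ≈⟨ distribʳ x 1# 1# ⟨
    (1# + 1#) · x     ∎

  [x+y]−[z+w]≈[x−z]+[y−w] : ∀ x y z w → (x + y) − (z + w) ≈ (x − z) + (y − w)
  [x+y]−[z+w]≈[x−z]+[y−w] x y z w =
    trans (+-congˡ (sym (⁻¹-∙-comm z w))) (interchange x y (- z) (- w))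

  infix  4 _≐_
  infixl 6 _+ᶠ_ _−ᶠ_
  infixl 7 _·ᶠ_
  infix  8 -ᶠ_

  _≐_ : Fn R q → Fn R q → Set ℓ
  g ≐ h = ∀ v → g v ≈ h v

  0ᶠ : Fn R q
  0ᶠ _ = 0#

  _+ᶠ_ _−ᶠ_ : Fn R q → Fn R q → Fn R q
  (g +ᶠ h) v = g v + h v
  (g −ᶠ h) v = g v − h v

  -ᶠ_ : Fn R q → Fn R q
  (-ᶠ g) v = - g v

  _·ᶠ_ : Carrier → Fn R q → Fn R q
  (a ·ᶠ g) v = a · g v

  index-cong₂ : ∀ (h : ℤ → Fn R q) {i i′ j j′} → i ≡ i′ → j ≡ j′ →
                h i +ᶠ h j ≐ h i′ +ᶠ h j′
  index-cong₂ h ≡.refl ≡.refl v = refl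

  record IsLinear (A : Op R q) : Set (c ⊔ ℓ) where
    field
      cong   : ∀ {g h} → g ≐ h → A g ≐ A h
      +-homo : ∀ g h → A (g +ᶠ h) ≐ A g +ᶠ A h
      ·-homo : ∀ a g → A (a ·ᶠ g) ≐ a ·ᶠ A g

    -‿homo : ∀ g → A (-ᶠ g) ≐ -ᶠ A g
    -‿homo g v = begin
      A (-ᶠ g) v        ≈⟨ cong (λ w → -1*x≈-x (g w)) v ⟨
      A (- 1# ·ᶠ g) v   ≈⟨ ·-homo (- 1#) g v ⟩
      - 1# · A g v      ≈⟨ -1*x≈-x (A g v) ⟩
      - A g v           ∎

    0-homo : A 0ᶠ ≐ 0ᶠ
    0-homo v = begin
      A 0ᶠ v            ≈⟨ cong (λ _ → zeroˡ 0#) v ⟨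
      A (0# ·ᶠ 0ᶠ) v    ≈⟨ ·-homo 0# 0ᶠ v ⟩
      0# · A 0ᶠ v       ≈⟨ zeroˡ _ ⟩
      0#                ∎

  open IsLinear

  isLinear-id : IsLinear id
  isLinear-id = record { cong = id ; +-homo = λ _ _ _ → refl ; ·-homo = λ _ _ _ → refl }

  isLinear-∘ : ∀ {A B} → IsLinear A → IsLinear B → IsLinear (A ∘ B)
  isLinear-∘ {B = B} LA LB = record
    { cong   = cong LA ∘ cong LB
    ; +-homo = λ g h v → trans (cong LA (+-homo LB g h) v) (+-homo LA (B g) (B h) v)
    ; ·-homo = λ a g v → trans (cong LA (·-homo LB a g) v) (·-homo LA a (B g) v)
    }

  isLinear-· : ∀ {A} a → IsLinear A → IsLinear (λ g → a ·ᶠ A g)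
  isLinear-· {A} a LA = record
    { cong   = λ e v → *-congˡ (cong LA e v)
    ; +-homo = λ g h v → trans (*-congˡ (+-homo LA g h v)) (distribˡ a (A g v) (A h v))
    ; ·-homo = λ b g v → trans (*-congˡ (·-homo LA b g v)) (x∙yz≈y∙xz a b (A g v))
    }

  isLinear-− : ∀ {A B} → IsLinear A → IsLinear B → IsLinear (λ g → A g −ᶠ B g)
  isLinear-− {A} {B} LA LB = record
    { cong   = λ e v → +-cong (cong LA e v) (-‿cong (cong LB e v))
    ; +-homo = λ g h v → trans (+-cong (+-homo LA g h v) (-‿cong (+-homo LB g h v)))
                               ([x+y]−[z+w]≈[x−z]+[y−w] _ _ _ _)
    ; ·-homo = λ a g v → trans (+-cong (·-homo LA a g v) (-‿cong (·-homo LB a g v)))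
                               (sym (x[y-z]≈xy-xz a (A g v) (B g v)))
    }

  isLinear-chebT : ∀ {A} → IsLinear A → ∀ m → IsLinear (chebT R A m)
  isLinear-chebT LA zero          = isLinear-id
  isLinear-chebT LA (suc zero)    = LA
  isLinear-chebT LA (suc (suc m)) =
    isLinear-− (isLinear-· (two R) (isLinear-∘ LA (isLinear-chebT LA (suc m)))) (isLinear-chebT LA m)

  sumFin≡sum : ∀ {n} (x : Fin n → Carrier) → sumFin R x ≡ sum x
  sumFin≡sum {zero}  x = ≡.refl
  sumFin≡sum {suc n} x = ≡.cong (λ t → x zero + t) (sumFin≡sum (x ∘ suc))

  isLinear-μ₁ : ∀ s → IsLinear (μ₁ R q s)
  isLinear-μ₁ s = record
    { cong   = λ e v → *-congˡ (sumFin-cong (e ∘ step v))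
    ; +-homo = λ g h v → trans (*-congˡ (sumFin-+ (g ∘ step v) (h ∘ step v))) (distribˡ s _ _)
    ; ·-homo = λ a g v → trans (*-congˡ (sumFin-· a (g ∘ step v))) (x∙yz≈y∙xz s a _)
    }
    where
    sumFin-cong : ∀ {n} {x y : Fin n → Carrier} → (∀ i → x i ≈ y i) → sumFin R x ≈ sumFin R y
    sumFin-cong {x = x} {y} e = begin
      sumFin R x  ≡⟨ sumFin≡sum x ⟩
      sum x       ≈⟨ sum-cong-≋ e ⟩
      sum y       ≡⟨ sumFin≡sum y ⟨
      sumFin R y  ∎

    sumFin-+ : ∀ {n} (x y : Fin n → Carrier) → sumFin R (λ i → x i + y i) ≈ sumFin R x + sumFin R y
    sumFin-+ x y = begin
      sumFin R (λ i → x i + y i)  ≡⟨ sumFin≡sum (λ i → x i + y i) ⟩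
      sum (λ i → x i + y i)       ≈⟨ ∑-distrib-+ x y ⟩
      sum x + sum y               ≡⟨ ≡.cong₂ _+_ (sumFin≡sum x) (sumFin≡sum y) ⟨
      sumFin R x + sumFin R y     ∎

    sumFin-· : ∀ {n} a (x : Fin n → Carrier) → sumFin R (λ i → a · x i) ≈ a · sumFin R x
    sumFin-· a x = begin
      sumFin R (λ i → a · x i)  ≡⟨ sumFin≡sum (λ i → a · x i) ⟩
      sum (λ i → a · x i)       ≈⟨ *-distribˡ-sum a x ⟨
      a · sum x                 ≡⟨ ≡.cong (a ·_) (sumFin≡sum x) ⟨
      a · sumFin R x            ∎

  -- Indexed by ℤ.suc n and ℤ.pred n rather than n + 1ℤ and n - 1ℤ because these
  -- compute on the constructors of ℤ.
  record WaveOf (A : Op R q) (h : ℤ → Fn R q) : Set ℓ where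
    field
      recurrence : ∀ n → h (ℤ.suc n) +ᶠ h (ℤ.pred n) ≐ two R ·ᶠ A (h n)

  open WaveOf

  isWave⇒waveOf : ∀ {s inv2} → two R · inv2 ≈ 1# → ∀ {f} → IsWave R q s inv2 f → WaveOf (μ₁ R q s) f
  isWave⇒waveOf {s} {inv2} two·inv2≈1 {f} f-wave .recurrence j v = begin
    f (ℤ.suc j) v + f (ℤ.pred j) v                    ≈⟨ index-cong₂ f (ℤ.+-comm 1ℤ j) (ℤ.+-comm -1ℤ j) v ⟩
    f (j ℤ.+ 1ℤ) v + f (j - 1ℤ) v                     ≈⟨ *-identityˡ _ ⟨
    1# · (f (j ℤ.+ 1ℤ) v + f (j - 1ℤ) v)              ≈⟨ *-congʳ two·inv2≈1 ⟨
    two R · inv2 · (f (j ℤ.+ 1ℤ) v + f (j - 1ℤ) v)    ≈⟨ *-assoc _ _ _ ⟩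
    two R · (inv2 · (f (j ℤ.+ 1ℤ) v + f (j - 1ℤ) v))  ≈⟨ *-congˡ (f-wave j v) ⟨
    two R · μ₁ R q s (f j) v                          ∎

  module _ {A : Op R q} (A-cong : ∀ {g h} → g ≐ h → A g ≐ A h)
           {g h : ℤ → Fn R q} (g-wave : WaveOf A g) (h-wave : WaveOf A h) where

    private
      sums-agree : ∀ n → g n ≐ h n → g (ℤ.suc n) +ᶠ g (ℤ.pred n) ≐ h (ℤ.suc n) +ᶠ h (ℤ.pred n)
      sums-agree n e v = begin
        g (ℤ.suc n) v + g (ℤ.pred n) v  ≈⟨ g-wave .recurrence n v ⟩
        two R · A (g n) v               ≈⟨ *-congˡ (A-cong e v) ⟩
        two R · A (h n) v               ≈⟨ h-wave .recurrence n v ⟨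
        h (ℤ.suc n) v + h (ℤ.pred n) v  ∎

      forward : ∀ n → g (ℤ.pred n) ≐ h (ℤ.pred n) → g n ≐ h n → g (ℤ.suc n) ≐ h (ℤ.suc n)
      forward n e₋ e v =
        ∙-cancelʳ (h (ℤ.pred n) v) _ _ (trans (+-congˡ (sym (e₋ v))) (sums-agree n e v))

      backward : ∀ n → g n ≐ h n → g (ℤ.suc n) ≐ h (ℤ.suc n) → g (ℤ.pred n) ≐ h (ℤ.pred n)
      backward n e e₊ v =
        ∙-cancelˡ (h (ℤ.suc n) v) _ _ (trans (+-congʳ (sym (e₊ v))) (sums-agree n e v))

    waveOf-unique : g 0ℤ ≐ h 0ℤ → g 1ℤ ≐ h 1ℤ → ∀ n → g n ≐ h n
    waveOf-unique e₀ e₁ (+ m)    = proj₁ (up m)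
      where
      up : ∀ m → g (+ m) ≐ h (+ m) × g (+ suc m) ≐ h (+ suc m)
      up zero    = e₀ , e₁
      up (suc m) = let e₋ , e = up m in e , forward (+ suc m) e₋ e
    waveOf-unique e₀ e₁ -[1+ m ] = proj₁ (down m)
      where
      down : ∀ m → g -[1+ m ] ≐ h -[1+ m ] × g (ℤ.suc -[1+ m ]) ≐ h (ℤ.suc -[1+ m ])
      down zero    = backward 0ℤ e₀ e₁ , e₀
      down (suc m) = let e , e₊ = down m in backward -[1+ m ] e e₊ , e

  module _ {A : Op R q} where

    waveOf-shift : ∀ {h} → WaveOf A h → ∀ j → WaveOf A (λ n → h (j ℤ.+ n))
    waveOf-shift {h} h-wave j .recurrence n v =
      trans (index-cong₂ h (i+[1+j]≡1+[i+j] j n) (ℤ.+-pred j n) v) (h-wave .recurrence (j ℤ.+ n) v)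

    waveOf-reflect : ∀ {h} → WaveOf A h → WaveOf A (λ n → h (ℤ.- n))
    waveOf-reflect {h} h-wave .recurrence n v =
      trans (index-cong₂ h (ℤ.neg-distrib-+ 1ℤ n) (ℤ.neg-distrib-+ -1ℤ n) v)
            (trans (+-comm _ _) (h-wave .recurrence (ℤ.- n) v))

    waveOf-chebT : ∀ g → WaveOf A (λ m → chebTℤ R A m g)
    waveOf-chebT g .recurrence (+ zero)       v = x+x≈two·x (A g v)
    waveOf-chebT g .recurrence (+ suc m)      v = //-rightDividesˡ _ _
    waveOf-chebT g .recurrence -[1+ zero ]    v = trans (+-comm _ _) (//-rightDividesˡ _ _)
    waveOf-chebT g .recurrence -[1+ suc m ]   v = trans (+-comm _ _) (//-rightDividesˡ _ _)

  module _ {A : Op R q} (A-linear : IsLinear A) where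
    waveOf-+ : ∀ {g h} → WaveOf A g → WaveOf A h → WaveOf A (λ n → g n +ᶠ h n)
    waveOf-+ {g} {h} g-wave h-wave .recurrence n v = begin
      (g (ℤ.suc n) v + h (ℤ.suc n) v) + (g (ℤ.pred n) v + h (ℤ.pred n) v)
        ≈⟨ interchange _ _ _ _ ⟩
      (g (ℤ.suc n) v + g (ℤ.pred n) v) + (h (ℤ.suc n) v + h (ℤ.pred n) v)
        ≈⟨ +-cong (g-wave .recurrence n v) (h-wave .recurrence n v) ⟩
      two R · A (g n) v + two R · A (h n) v  ≈⟨ distribˡ _ _ _ ⟨
      two R · (A (g n) v + A (h n) v)        ≈⟨ *-congˡ (+-homo A-linear (g n) (h n) v) ⟨
      two R · A (g n +ᶠ h n) v               ∎

    -[two·Ag]≈two·A[-g] : ∀ g v → - (two R · A g v) ≈ two R · A (-ᶠ g) v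
    -[two·Ag]≈two·A[-g] g v = trans (-‿distribʳ-* _ _) (*-congˡ (sym (-‿homo A-linear g v)))

    waveOf-neg : ∀ {h} → WaveOf A h → WaveOf A (λ n → -ᶠ h n)
    waveOf-neg {h} h-wave .recurrence n v =
      trans (⁻¹-∙-comm _ _) (trans (-‿cong (h-wave .recurrence n v)) (-[two·Ag]≈two·A[-g] (h n) v))

    waveOf-· : ∀ {h} a → WaveOf A h → WaveOf A (λ n → a ·ᶠ h n)
    waveOf-· {h} a h-wave .recurrence n v = begin
      a · h (ℤ.suc n) v + a · h (ℤ.pred n) v  ≈⟨ distribˡ _ _ _ ⟨
      a · (h (ℤ.suc n) v + h (ℤ.pred n) v)    ≈⟨ *-congˡ (h-wave .recurrence n v) ⟩
      a · (two R · A (h n) v)                 ≈⟨ x∙yz≈y∙xz _ _ _ ⟩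
      two R · (a · A (h n) v)                 ≈⟨ *-congˡ (·-homo A-linear a (h n) v) ⟨
      two R · A (a ·ᶠ h n) v                  ∎

    waveOf-chebU : ∀ g → WaveOf A (λ n → chebUℤ R A (ℤ.pred n) g)
    waveOf-chebU g .recurrence (+ zero)            v = begin
      g v + - g v        ≈⟨ -‿inverseʳ _ ⟩
      0#                 ≈⟨ zeroʳ _ ⟨
      two R · 0#         ≈⟨ *-congˡ (0-homo A-linear v) ⟨
      two R · A 0ᶠ v     ∎
    waveOf-chebU g .recurrence (+ suc zero)        v = +-identityʳ _
    waveOf-chebU g .recurrence (+ suc (suc m))     v = //-rightDividesˡ _ _
    waveOf-chebU g .recurrence -[1+ zero ]         v = trans (+-identityˡ _) (-[two·Ag]≈two·A[-g] g v)
    waveOf-chebU g .recurrence -[1+ suc m ]        v = begin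
      - chebU R A m g v + - chebU R A (suc (suc m)) g v    ≈⟨ +-comm _ _ ⟩
      - chebU R A (suc (suc m)) g v + - chebU R A m g v    ≈⟨ ⁻¹-∙-comm _ _ ⟩
      - (chebU R A (suc (suc m)) g v + chebU R A m g v)    ≈⟨ -‿cong (//-rightDividesˡ _ _) ⟩
      - (two R · A (chebU R A (suc m) g) v)                ≈⟨ -[two·Ag]≈two·A[-g] _ v ⟩
      two R · A (-ᶠ chebU R A (suc m) g) v                 ∎

    waveOf-translates : ∀ {f} → WaveOf A f →
      ∀ j m → f (j ℤ.+ m) +ᶠ f (j - m) ≐ two R ·ᶠ chebTℤ R A m (f j)
    waveOf-translates {f} f-wave j =
      waveOf-unique (cong A-linear)
        (waveOf-+ shifted (waveOf-reflect shifted)) (waveOf-· (two R) (waveOf-chebT (f j))) at-0 at-1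
      where
      shifted : WaveOf A (λ n → f (j ℤ.+ n))
      shifted = waveOf-shift f-wave j

      at-0 : f (j ℤ.+ 0ℤ) +ᶠ f (j - 0ℤ) ≐ two R ·ᶠ f j
      at-0 v = trans (index-cong₂ f (ℤ.+-identityʳ j) (ℤ.+-identityʳ j) v) (x+x≈two·x (f j v))

      at-1 : f (j ℤ.+ 1ℤ) +ᶠ f (j - 1ℤ) ≐ two R ·ᶠ A (f j)
      at-1 v = trans (index-cong₂ f (ℤ.+-comm j 1ℤ) (ℤ.+-comm j -1ℤ) v) (f-wave .recurrence j v)

    waveOf-sample : ∀ {f} → WaveOf A f → ∀ k → WaveOf (chebTℤ R A k) (λ n → f (n * k))
    waveOf-sample {f} f-wave k .recurrence n v =
      trans (index-cong₂ f ([1+n]*k≡n*k+k n k) ([-1+n]*k≡n*k-k n k) v)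
            (waveOf-translates f-wave (n * k) k v)

    waveOf-chebU-expansion : ∀ {h} → WaveOf A h →
      ∀ n → h n ≐ chebUℤ R A (n - 1ℤ) (h 1ℤ) −ᶠ chebUℤ R A (n - + 2) (h 0ℤ)
    waveOf-chebU-expansion {h} h-wave n v = begin
      h n v
        ≈⟨ waveOf-unique (cong A-linear) h-wave expansion-wave at-0 at-1 n v ⟩
      chebUℤ R A (ℤ.pred n) (h 1ℤ) v − chebUℤ R A (ℤ.pred (ℤ.pred n)) (h 0ℤ) v
        ≡⟨ ≡.cong₂ (λ i j → chebUℤ R A i (h 1ℤ) v − chebUℤ R A j (h 0ℤ) v)
                   (ℤ.+-comm -1ℤ n) (-1+[-1+n]≡n-2 n) ⟩
      chebUℤ R A (n - 1ℤ) (h 1ℤ) v − chebUℤ R A (n - + 2) (h 0ℤ) v ∎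
      where
      expansion-wave :
        WaveOf A (λ n → chebUℤ R A (ℤ.pred n) (h 1ℤ) −ᶠ chebUℤ R A (ℤ.pred (ℤ.pred n)) (h 0ℤ))
      expansion-wave =
        waveOf-+ (waveOf-chebU (h 1ℤ)) (waveOf-neg (waveOf-shift (waveOf-chebU (h 0ℤ)) -1ℤ))

      at-0 : h 0ℤ ≐ 0ᶠ −ᶠ -ᶠ h 0ℤ
      at-0 v = sym (trans (+-identityˡ _) (⁻¹-involutive _))

      at-1 : h 1ℤ ≐ h 1ℤ −ᶠ 0ᶠ
      at-1 v = sym (trans (+-congˡ ε⁻¹≈ε) (+-identityʳ _))

theorem4p2 : ∀ {c ℓ} (R : CommutativeRing c ℓ) (q : ℕ) → 1 ≤ q →
    (invq1 inv2 : CommutativeRing.Carrier R) →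
    CommutativeRing._≈_ R (CommutativeRing._*_ R (fromℕ R (ℕ.suc q)) invq1) (CommutativeRing.1# R) →
    CommutativeRing._≈_ R (CommutativeRing._*_ R (two R) inv2) (CommutativeRing.1# R) →
    (f : ℤ → Fn R q) → IsWave R q invq1 inv2 f →
    (n k : ℤ) (v : Vertex q) →
      CommutativeRing._≈_ R (f (n * k) v)
        (CommutativeRing._-_ R
          (chebUℤ R (chebTℤ R (μ₁ R q invq1) k) (n - 1ℤ) (f k) v)
          (chebUℤ R (chebTℤ R (μ₁ R q invq1) k) (n - + 2) (f 0ℤ) v))
-- Only the linearity of μ₁ enters.
theorem4p2 R q _ invq1 inv2 _ two·inv2≈1 f f-wave n k v = begin
  f (n * k) v
    ≈⟨ waveOf-chebU-expansion (isLinear-chebT μ-linear ∣ k ∣)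
         (waveOf-sample μ-linear (isWave⇒waveOf two·inv2≈1 {f} f-wave) k) n v ⟩
  chebUℤ R T (n - 1ℤ) (f (1ℤ * k)) v − chebUℤ R T (n - + 2) (f 0ℤ) v
    ≡⟨ ≡.cong (λ i → chebUℤ R T (n - 1ℤ) (f i) v − chebUℤ R T (n - + 2) (f 0ℤ) v)
              (ℤ.*-identityˡ k) ⟩
  chebUℤ R T (n - 1ℤ) (f k) v − chebUℤ R T (n - + 2) (f 0ℤ) v ∎
  where
  open Waves R q
  open CommutativeRing R using (setoid) renaming (_-_ to _−_)
  open SetoidReasoning setoid

  μ-linear : IsLinear (μ₁ R q invq1)
  μ-linear = isLinear-μ₁ invq1

  T : Op R q
  T = chebTℤ R (μ₁ R q invq1) k
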